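{- Let $(h,n)=(3,2)$ and $U=\{id\}\times S_2\le S_3\times S_2$. Then $U$ is a neutrality group but not a symmetry group with respect to $(3,2)$.
   Context: Let $G=S_h\times S_n$, $\mathcal P=(S_n)^h$, with $G$ acting on $\mathcal P$: $p^{(\varphi,\psi)}$ has $i$-th component $\psi\,p_{\varphi^{ -1}(i)}$ (products are compositions). An SPF is a map $F:\mathcal P\to S_n$; its symmetry group is $G(F)=\{(\varphi,\psi)\in G:F(p^{(\varphi,\psi)})=\psi F(p)\ \forall p\}$ and its neutrality group is $G_2(F)=G(F)\cap(\{id\}\times S_n)$. $U$ is a symmetry group (resp. neutrality group) if $U=G(F)$ (resp. $U=G_2(F)$) for some SPF $F$. -}

module Defs where

open import Data.Nat using (ℕ)
open import Data.Fin using (Fin)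
open import Data.Product using (Σ; _×_; _,_; proj₁; proj₂)
open import Relation.Binary.PropositionalEquality using (_≡_)
open import Data.Fin.Permutation
  using (Permutation′; _⟨$⟩ʳ_; _⟨$⟩ˡ_; _∘ₚ_; id)
  renaming (_≈_ to _≈ₚ_)

Perm : ℕ → Set
Perm n = Permutation′ n

-- Composition in the usual (right-to-left) order: (ψ ⊙ π)(i) = ψ (π i).
_⊙_ : ∀ {n} → Perm n → Perm n → Perm n
ψ ⊙ π = π ∘ₚ ψ

Profile : ℕ → ℕ → Set
Profile h n = Fin h → Perm n

_≈P_ : ∀ {h n} → Profile h n → Profile h n → Set
p ≈P q = ∀ i → p i ≈ₚ q i

G : ℕ → ℕ → Set
G h n = Perm h × Perm n

act : ∀ {h n} → Profile h n → G h n → Profile h n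
act p (φ , ψ) i = ψ ⊙ p (φ ⟨$⟩ˡ i)

-- An SPF is a map P → S_n.  Since permutations are functions compared
-- pointwise, a map of sets P → S_n is a function respecting pointwise
-- equality.
record SPF (h n : ℕ) : Set where
  field
    F    : Profile h n → Perm n
    cong : ∀ {p q} → p ≈P q → F p ≈ₚ F q
open SPF public

InSym : ∀ {h n} → SPF h n → G h n → Set
InSym 𝓕 (φ , ψ) = ∀ p → F 𝓕 (act p (φ , ψ)) ≈ₚ (ψ ⊙ F 𝓕 p)

InIdS : ∀ {h n} → G h n → Set
InIdS (φ , ψ) = φ ≈ₚ id

InNeut : ∀ {h n} → SPF h n → G h n → Set
InNeut 𝓕 g = InSym 𝓕 g × InIdS g

SubsetG : ℕ → ℕ → Set₁
SubsetG h n = G h n → Set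

_≐_ : ∀ {h n} → SubsetG h n → SubsetG h n → Set
U ≐ V = ∀ g → (U g → V g) × (V g → U g)

IsSymmetryGroup : (h n : ℕ) → SubsetG h n → Set
IsSymmetryGroup h n U = Σ (SPF h n) (λ 𝓕 → U ≐ InSym 𝓕)

IsNeutralityGroup : (h n : ℕ) → SubsetG h n → Set
IsNeutralityGroup h n U = Σ (SPF h n) (λ 𝓕 → U ≐ InNeut 𝓕)

-- A dictator p ↦ p₁ commutes with every relabelling of the alternatives and with
-- no relabelling of the voters, so {id} × S₂ is its neutrality group. Conversely,
-- an SPF with symmetry group {id} × S₂ is neutral, so for n = 2 it is a self-dual
-- Boolean function g of the three voters' rankings. Two of g(100), g(010), g(001)
-- agree, say g(100) = g(010); self-duality gives g(011) = g(101), so g is invariant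
-- under swapping the first two voters, and that swap lies in the symmetry group.
module Submission where

open import Defs hiding (cong)
open import Data.Bool using (Bool; true; false; not)
open import Data.Fin using (Fin; zero; suc)
open import Data.Fin.Permutation
  using (_⟨$⟩ʳ_; _⟨$⟩ˡ_; inverseˡ; transpose)
  renaming (_≈_ to _≈ₚ_; id to idₚ)
open import Data.Fin.Properties using (2↔Bool; _≟_)
open import Data.Nat using (suc)
open import Data.Product using (Σ-syntax; _×_; _,_; proj₁; proj₂)
open import Data.Sum using (_⊎_; inj₁; inj₂)
open import Data.Vec.Functional using (Vector; _∷_; [])
open import Function using (_∘_)
open import Function.Bundles using (Inverse; Injection)
open import Function.Properties.Inverse using (↔⇒↣)
open import Relation.Nullary using (¬_)
open import Relation.Nullary.Decidable using (dec-true)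
open import Relation.Binary.PropositionalEquality
  using (_≡_; _≢_; refl; sym; trans; cong; module ≡-Reasoning)

dictator : ∀ {h n} → SPF (suc h) n
dictator = record { F = λ p → p zero ; cong = λ p≈q → p≈q zero }

dictator-symmetric : ∀ {h n} (g : G (suc h) n) → InIdS g → InSym dictator g
dictator-symmetric (φ , ψ) φ≈id p i = cong (λ k → (ψ ⊙ p k) ⟨$⟩ʳ i) φ⁻¹0≡0
  where
  φ⁻¹0≡0 : φ ⟨$⟩ˡ zero ≡ zero
  φ⁻¹0≡0 = trans (cong (φ ⟨$⟩ˡ_) (sym (φ≈id zero))) (inverseˡ φ)

dictator-neutralityGroup : ∀ {h n} → IsNeutralityGroup (suc h) n InIdS
dictator-neutralityGroup =
  dictator , λ g → (λ g∈U → dictator-symmetric g g∈U , g∈U) , proj₂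

perm : Bool → Perm 2
perm false = idₚ
perm true  = transpose zero (suc zero)

toBool : Fin 2 → Bool
toBool = Inverse.to 2↔Bool

-- sign π records whether π swaps the two alternatives; perm is its inverse.
sign : Perm 2 → Bool
sign π = toBool (π ⟨$⟩ʳ zero)

perm-sign : (π : Perm 2) → π ≈ₚ perm (sign π)
perm-sign π with π ⟨$⟩ʳ zero in π0 | π ⟨$⟩ʳ suc zero in π1
... | zero     | suc zero = λ { zero → π0 ; (suc zero) → π1 }
... | suc zero | zero     = λ { zero → π0 ; (suc zero) → π1 }
... | zero     | zero     with () ← Injection.injective (↔⇒↣ π) (trans π0 (sym π1))
... | suc zero | suc zero with () ← Injection.injective (↔⇒↣ π) (trans π0 (sym π1))

perm-not : ∀ b → perm (not b) ≈ₚ perm true ⊙ perm b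
perm-not false zero       = refl
perm-not false (suc zero) = refl
perm-not true  zero       = refl
perm-not true  (suc zero) = refl

-- For two alternatives an SPF is, up to perm and sign, a Boolean function of the
-- voters' rankings; neutrality becomes self-duality of that function.
code : ∀ {h} → SPF h 2 → Vector Bool h → Bool
code 𝓕 v = sign (F 𝓕 (perm ∘ v))

module _ {h} (𝓕 : SPF h 2) where

  code-cong : ∀ {v w} → (∀ i → v i ≡ w i) → code 𝓕 v ≡ code 𝓕 w
  code-cong v≗w = cong toBool
    (SPF.cong 𝓕 (λ i j → cong (λ b → perm b ⟨$⟩ʳ j) (v≗w i)) zero)

  F≈perm∘code : ∀ p → F 𝓕 p ≈ₚ perm (code 𝓕 (sign ∘ p))
  F≈perm∘code p j =
    trans (SPF.cong 𝓕 (perm-sign ∘ p) j) (perm-sign (F 𝓕 (perm ∘ sign ∘ p)) j)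

  code-selfDual : InSym 𝓕 (idₚ , perm true) → ∀ v → code 𝓕 (not ∘ v) ≡ not (code 𝓕 v)
  code-selfDual neutral v = begin
    toBool (F 𝓕 (perm ∘ not ∘ v) ⟨$⟩ʳ zero)                    ≡⟨ cong toBool (SPF.cong 𝓕 (perm-not ∘ v) zero) ⟩
    toBool (F 𝓕 (act (perm ∘ v) (idₚ , perm true)) ⟨$⟩ʳ zero) ≡⟨ cong toBool (neutral (perm ∘ v) zero) ⟩
    toBool (perm true ⟨$⟩ʳ (F 𝓕 (perm ∘ v) ⟨$⟩ʳ zero))        ≡⟨ toBool-swap (F 𝓕 (perm ∘ v) ⟨$⟩ʳ zero) ⟩
    not (code 𝓕 v)                                             ∎
    where
    open ≡-Reasoning
    toBool-swap : ∀ k → toBool (perm true ⟨$⟩ʳ k) ≡ not (toBool k)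
    toBool-swap zero       = refl
    toBool-swap (suc zero) = refl

  InSym-voterPerm : ∀ φ → (∀ v → code 𝓕 (v ∘ (φ ⟨$⟩ˡ_)) ≡ code 𝓕 v) → InSym 𝓕 (φ , idₚ)
  InSym-voterPerm φ invariant p j = begin
    F 𝓕 (act p (φ , idₚ)) ⟨$⟩ʳ j                ≡⟨ F≈perm∘code (act p (φ , idₚ)) j ⟩
    perm (code 𝓕 (sign ∘ p ∘ (φ ⟨$⟩ˡ_))) ⟨$⟩ʳ j ≡⟨ cong (λ b → perm b ⟨$⟩ʳ j) (invariant (sign ∘ p)) ⟩
    perm (code 𝓕 (sign ∘ p)) ⟨$⟩ʳ j             ≡⟨ sym (F≈perm∘code p j) ⟩
    F 𝓕 p ⟨$⟩ʳ j                                 ∎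
    where open ≡-Reasoning

transpose-moves : ∀ {n} (i j : Fin n) → transpose i j ⟨$⟩ʳ i ≡ j
transpose-moves i j rewrite dec-true (i ≟ i) refl = refl

transpose-nontrivial : ∀ {n} {i j : Fin n} → i ≢ j → ¬ transpose i j ≈ₚ idₚ
transpose-nontrivial {i = i} {j} i≢j τ≈id = i≢j (trans (sym (τ≈id i)) (transpose-moves i j))

SelfDual₃ : (Bool → Bool → Bool → Bool) → Set
SelfDual₃ g = ∀ x y z → g (not x) (not y) (not z) ≡ not (g x y z)

selfDual₃-swap₁₂ : ∀ g → SelfDual₃ g → g true false false ≡ g false true false →
                   ∀ x y z → g y x z ≡ g x y z
selfDual₃-swap₁₂ g sd g100≡g010 = λ where
  false false z     → refl
  true  true  z     → refl
  true  false false → sym g100≡g010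
  false true  false → g100≡g010
  true  false true  → trans (sd true false false) (trans (cong not g100≡g010) (sym (sd false true false)))
  false true  true  → trans (sd false true false) (trans (cong not (sym g100≡g010)) (sym (sd true false false)))

two-agree : (a b c : Bool) → a ≡ b ⊎ a ≡ c ⊎ b ≡ c
two-agree false false c     = inj₁ refl
two-agree true  true  c     = inj₁ refl
two-agree false true  false = inj₂ (inj₁ refl)
two-agree false true  true  = inj₂ (inj₂ refl)
two-agree true  false false = inj₂ (inj₂ refl)
two-agree true  false true  = inj₂ (inj₁ refl)

module _ (g : Vector Bool 3 → Bool) (g-cong : ∀ {v w} → (∀ i → v i ≡ w i) → g v ≡ g w)
         (selfDual : ∀ v → g (not ∘ v) ≡ not (g v)) where

  private
    g₃ : Bool → Bool → Bool → Bool
    g₃ x y z = g (x ∷ y ∷ z ∷ [])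

    g≡g₃ : ∀ v → g v ≡ g₃ (v zero) (v (suc zero)) (v (suc (suc zero)))
    g≡g₃ v = g-cong λ where
      zero             → refl
      (suc zero)       → refl
      (suc (suc zero)) → refl

    selfDual-g₃ : SelfDual₃ g₃
    selfDual-g₃ x y z = trans (sym (g≡g₃ (not ∘ (x ∷ y ∷ z ∷ [])))) (selfDual (x ∷ y ∷ z ∷ []))

    transposition-invariant :
      ∀ i j → i ≢ j → let φ = transpose i j in
      (∀ v → g₃ (v (φ ⟨$⟩ˡ zero)) (v (φ ⟨$⟩ˡ suc zero)) (v (φ ⟨$⟩ˡ suc (suc zero)))
             ≡ g₃ (v zero) (v (suc zero)) (v (suc (suc zero)))) →
      Σ[ φ ∈ Perm 3 ] ¬ φ ≈ₚ idₚ × (∀ v → g (v ∘ (φ ⟨$⟩ˡ_)) ≡ g v)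
    transposition-invariant i j i≢j inv₃ =
      transpose i j , transpose-nontrivial i≢j ,
      λ v → trans (g≡g₃ (v ∘ (transpose i j ⟨$⟩ˡ_))) (trans (inv₃ v) (sym (g≡g₃ v)))

  selfDual₃-transpositionInvariant :
    Σ[ φ ∈ Perm 3 ] ¬ φ ≈ₚ idₚ × (∀ v → g (v ∘ (φ ⟨$⟩ˡ_)) ≡ g v)
  selfDual₃-transpositionInvariant
    with two-agree (g₃ true false false) (g₃ false true false) (g₃ false false true)
  ... | inj₁ g100≡g010 =
    transposition-invariant zero (suc zero) (λ ()) λ v →
      selfDual₃-swap₁₂ g₃ selfDual-g₃ g100≡g010
        (v zero) (v (suc zero)) (v (suc (suc zero)))
  ... | inj₂ (inj₁ g100≡g001) =
    transposition-invariant zero (suc (suc zero)) (λ ()) λ v →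
      selfDual₃-swap₁₂ (λ x y z → g₃ x z y) (λ x y z → selfDual-g₃ x z y) g100≡g001
        (v zero) (v (suc (suc zero))) (v (suc zero))
  ... | inj₂ (inj₂ g010≡g001) =
    transposition-invariant (suc zero) (suc (suc zero)) (λ ()) λ v →
      selfDual₃-swap₁₂ (λ x y z → g₃ z x y) (λ x y z → selfDual-g₃ z x y) g010≡g001
        (v (suc zero)) (v (suc (suc zero))) (v zero)

idS-not-symmetryGroup : ¬ IsSymmetryGroup 3 2 InIdS
idS-not-symmetryGroup (𝓕 , U≐G𝓕) =
  let neutral = proj₁ (U≐G𝓕 (idₚ , perm true)) (λ _ → refl)
      φ , φ≉id , invariant =
        selfDual₃-transpositionInvariant (code 𝓕) (code-cong 𝓕) (code-selfDual 𝓕 neutral)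
  in φ≉id (proj₂ (U≐G𝓕 (φ , idₚ)) (InSym-voterPerm 𝓕 φ invariant))

proposition44 : IsNeutralityGroup 3 2 InIdS × ¬ IsSymmetryGroup 3 2 InIdS
proposition44 = dictator-neutralityGroup , idS-not-symmetryGroup
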